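{- Let $n>l\geq 1$ be integers and let $D(n,l)$ be the dandelion graph on $n$ vertices, obtained by identifying the center of the star $K_{1,n-l}$ with an end vertex of the path $P_l$. Then its Kemeny's constant is $$\kappa(D(n,l))= \frac{(n+1)(2l^2-1)+2n(n-3l)}{2(n-1)}+\frac{l(5-2l^2)}{3(n-1)}.$$
   Context: For a connected graph $G$ with $m$ edges and vertices $v_1,\dots,v_N$ of degrees $d_1,\dots,d_N$, the resistance distance $r_{ij}$ is the effective resistance between $v_i$ and $v_j$ when every edge is a resistor of $1\Omega$ (equivalently $r_{ij}=l^{\#}_{ii}+l^{\#}_{jj}-2l^{\#}_{ij}$ with $L^{\#}$ the group inverse of the Laplacian $L=D-A$), and Kemeny's constant is $\kappa(G)=\frac{1}{4m}\sum_{v_i,v_j\in V(G)} d_i d_j r_{ij}$, the sum running over all ordered pairs $(v_i,v_j)\in V(G)\times V(G)$. -}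

module Defs where

open import Data.Bool using (Bool; true; false; if_then_else_; _∧_; _∨_)
open import Data.Nat as ℕ using (ℕ; zero; suc; _≡ᵇ_; _<ᵇ_; _∸_)
open import Data.Fin using (Fin; toℕ)
open import Data.Integer using (+_)
open import Data.Rational using (ℚ; 0ℚ; 1ℚ; _+_; _-_; _*_; 1/_; _/_; ≢-nonZero)
open import Data.Rational.Properties using (_≟_)
open import Relation.Binary.PropositionalEquality using (_≡_)
open import Relation.Nullary using (yes; no)
open import Data.Product using (Σ; _×_)

ℕ→ℚ : ℕ → ℚ
ℕ→ℚ n = (+ n) / 1

-- total inverse on ℚ: inverse of p when p ≠ 0 (only ever applied to nonzero values here)
inv : ℚ → ℚ
inv p with p ≟ 0ℚ
... | yes _ = 0ℚ
... | no p≢0 = 1/_ p {{≢-nonZero p≢0}}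

sumFin : ∀ {N} → (Fin N → ℚ) → ℚ
sumFin {zero} f = 0ℚ
sumFin {suc N} f = f Fin.zero + sumFin (λ i → f (Fin.suc i))

-- A (simple) graph on vertex set Fin N given by its 0/1 adjacency matrix over ℚ

Adj : ℕ → Set
Adj N = Fin N → Fin N → ℚ

deg : ∀ {N} → Adj N → Fin N → ℚ
deg A i = sumFin (λ j → A i j)

-- number of edges m (as a rational): 2m = sum of degrees
edges : ∀ {N} → Adj N → ℚ
edges A = (+ 1 / 2) * sumFin (deg A)

lap : ∀ {N} → Adj N → (Fin N → ℚ) → (Fin N → ℚ)
lap A x i = deg A i * x i - sumFin (λ j → A i j * x j)

e : ∀ {N} → Fin N → Fin N → ℚ
e i k = if toℕ i ≡ᵇ toℕ k then 1ℚ else 0ℚ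

-- Effective resistance (electrical definition): injecting a unit current at v_i
-- and extracting it at v_j, the node potentials x satisfy L x = e_i - e_j
-- (Kirchhoff/Ohm with 1Ω edges), and r_ij = x_i - x_j.
-- A "potential system" gives, for each ordered pair (i,j), such a potential vector.
IsPotentials : ∀ {N} → Adj N → (Fin N → Fin N → Fin N → ℚ) → Set
IsPotentials {N} A P = ∀ (i j k : Fin N) → lap A (P i j) k ≡ e i k - e j k

resistance : ∀ {N} → (Fin N → Fin N → Fin N → ℚ) → Fin N → Fin N → ℚ
resistance P i j = P i j i - P i j j

kemeny : ∀ {N} → Adj N → (Fin N → Fin N → Fin N → ℚ) → ℚ
kemeny A P =
  inv (ℕ→ℚ 4 * edges A) *
  sumFin (λ i → sumFin (λ j → deg A i * deg A j * resistance P i j))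

-- Dandelion graph D(n,l) on vertices 0,…,n-1:
-- path P_l on vertices 0,…,l-1 (edges {a,a+1}, a+1 < l), and the star K_{1,n-l}
-- whose center is the path end vertex l-1 and whose leaves are l,…,n-1.

dandelionAdjᵇ : ℕ → ℕ → ℕ → Bool
dandelionAdjᵇ l a b =
     ((suc a ≡ᵇ b) ∧ (b <ᵇ l))
  ∨ ((suc b ≡ᵇ a) ∧ (a <ᵇ l))
  ∨ ((a ≡ᵇ (l ∸ 1)) ∧ ((l ∸ 1) <ᵇ b))
  ∨ ((b ≡ᵇ (l ∸ 1)) ∧ ((l ∸ 1) <ᵇ a))

dandelion : (n l : ℕ) → Adj n
dandelion n l i j = if dandelionAdjᵇ l (toℕ i) (toℕ j) then 1ℚ else 0ℚ

dandelionKemeny : ℕ → ℕ → ℚ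
dandelionKemeny n l =
    (ℕ→ℚ (suc n) * (ℕ→ℚ 2 * L * L - 1ℚ) + ℕ→ℚ 2 * N * (N - ℕ→ℚ 3 * L))
      * inv (ℕ→ℚ 2 * (N - 1ℚ))
  + (L * (ℕ→ℚ 5 - ℕ→ℚ 2 * L * L)) * inv (ℕ→ℚ 3 * (N - 1ℚ))
  where
    N = ℕ→ℚ n
    L = ℕ→ℚ l

{-# OPTIONS --safe #-}
-- Ground the network at the centre c = l − 1.  For a vertex i let U i be the potential of a unit
-- current entering at i and leaving at c, normalised by U i c = 0: along the path it is
-- U i b = (c − max(i, b))⁺, and for a leaf i it is the indicator of i.  The differences U i − U j
-- form a potential system, and since the Laplacian L is self-adjoint the resistances, hence κ, do
-- not depend on the system chosen.  Expanding r_ij = U_i(i) − U_j(i) − U_i(j) + U_j(j) and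
-- symmetrising gives
--   Σ_{i,j} d_i d_j r_ij = 2 Σ_a d_a (2m U_a(a) − Σ_b d_b U_a(b)),
-- and self-adjointness once more gives Σ_b d_b U_a(b) = z_a − z_c for any z with L z = d − 2m e_c;
-- on the dandelion z_b = c² − b² along the path and 1 at the leaves.  What remains is a sum over
-- the path, Σ_{a<c} d_a ((c − a) 2m − (c² − a²)) = 2m c² − (4c³ − c)/3, found by induction on c.

module Submission where

open import Data.Bool using (Bool; true; false; if_then_else_; _∧_; _∨_)
open import Data.Bool.Properties using (T-≡; ¬-not; ∧-identityʳ; ∧-zeroʳ; ∨-identityʳ; ∨-comm)
open import Data.Empty using (⊥-elim)
open import Data.Fin as Fin using (Fin; toℕ)
open import Data.Fin.Properties using (toℕ<n; toℕ-fromℕ<)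
import Data.Integer as ℤ
import Data.Integer.Properties as ℤP
open import Data.Nat as ℕ using (ℕ; zero; suc; _≡ᵇ_; _<ᵇ_; _∸_; _⊔_; _≤_; _<_; z≤n; s≤s)
open import Data.Nat.Coprimality using (1-coprimeTo) renaming (sym to coprime-sym)
import Data.Nat.Properties as ℕP
open import Data.Product using (Σ; _×_; _,_)
open import Data.Rational using (ℚ; 0ℚ; 1ℚ; _+_; _-_; _*_; _/_; toℚᵘ; ≢-nonZero)
import Data.Rational.Properties as ℚP
open import Algebra.Properties.Ring ℚP.+-*-ring using (x[y-z]≈xy-xz)
open import Data.Rational.Solver using (module +-*-Solver)
import Data.Rational.Unnormalised as ℚᵘ
import Data.Rational.Unnormalised.Properties as ℚᵘP
open import Data.Sum using (inj₁; inj₂)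
open import Function using (_∘_; Equivalence)
open import Relation.Binary.Definitions using (tri<; tri≈; tri>)
open import Relation.Binary.PropositionalEquality
open import Relation.Nullary using (yes; no; Dec)

open import Defs

open +-*-Solver

toℚᵘ-ℕ→ℚ : ∀ n → toℚᵘ (ℕ→ℚ n) ≡ ℚᵘ.mkℚᵘ (ℤ.+ n) 0
toℚᵘ-ℕ→ℚ n = cong toℚᵘ (ℚP.normalize-coprime (coprime-sym (1-coprimeTo n)))

ℕ→ℚ-+ : ∀ m n → ℕ→ℚ (m ℕ.+ n) ≡ ℕ→ℚ m + ℕ→ℚ n
ℕ→ℚ-+ m n = ℚP.toℚᵘ-injective (begin
  toℚᵘ (ℕ→ℚ (m ℕ.+ n))                  ≡⟨ toℚᵘ-ℕ→ℚ (m ℕ.+ n) ⟩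
  ℚᵘ.mkℚᵘ (ℤ.+ (m ℕ.+ n)) 0             ≈⟨ ℚᵘ.*≡* (trans (ℤP.*-identityʳ _) (sym ×1)) ⟩
  ℚᵘ.mkℚᵘ (ℤ.+ m) 0 ℚᵘ.+ ℚᵘ.mkℚᵘ (ℤ.+ n) 0  ≡⟨ sym (cong₂ ℚᵘ._+_ (toℚᵘ-ℕ→ℚ m) (toℚᵘ-ℕ→ℚ n)) ⟩
  toℚᵘ (ℕ→ℚ m) ℚᵘ.+ toℚᵘ (ℕ→ℚ n)        ≈⟨ ℚᵘP.≃-sym (ℚP.toℚᵘ-homo-+ (ℕ→ℚ m) (ℕ→ℚ n)) ⟩
  toℚᵘ (ℕ→ℚ m + ℕ→ℚ n)                  ∎)
  where
  open ℚᵘP.≃-Reasoning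
  ×1 : (ℤ.+ m ℤ.* ℤ.+ 1 ℤ.+ ℤ.+ n ℤ.* ℤ.+ 1) ℤ.* ℤ.+ 1 ≡ ℤ.+ (m ℕ.+ n)
  ×1 = trans (ℤP.*-identityʳ _) (cong₂ ℤ._+_ (ℤP.*-identityʳ (ℤ.+ m)) (ℤP.*-identityʳ (ℤ.+ n)))

ℕ→ℚ-suc : ∀ n → ℕ→ℚ (suc n) ≡ 1ℚ + ℕ→ℚ n
ℕ→ℚ-suc = ℕ→ℚ-+ 1

ℕ→ℚ-∸ : ∀ {m n} → n ≤ m → ℕ→ℚ (m ∸ n) ≡ ℕ→ℚ m - ℕ→ℚ n
ℕ→ℚ-∸ {m} {n} n≤m = begin
  ℕ→ℚ (m ∸ n)                       ≡⟨ solve 2 (λ x y → x := (y :+ x) :- y) refl (ℕ→ℚ (m ∸ n)) (ℕ→ℚ n) ⟩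
  (ℕ→ℚ n + ℕ→ℚ (m ∸ n)) - ℕ→ℚ n    ≡⟨ cong (_- ℕ→ℚ n) (sym (ℕ→ℚ-+ n (m ∸ n))) ⟩
  ℕ→ℚ (n ℕ.+ (m ∸ n)) - ℕ→ℚ n       ≡⟨ cong (λ x → ℕ→ℚ x - ℕ→ℚ n) (ℕP.m+[n∸m]≡n n≤m) ⟩
  ℕ→ℚ m - ℕ→ℚ n                     ∎
  where open ≡-Reasoning

inv-inverseʳ : ∀ {x} → x ≢ 0ℚ → x * inv x ≡ 1ℚ
inv-inverseʳ {x} x≢0 with x ℚP.≟ 0ℚ
... | yes x≡0 = ⊥-elim (x≢0 x≡0)
... | no x≢0 = ℚP.*-inverseʳ x {{≢-nonZero x≢0}}

inv-unique : ∀ {a y} → a * y ≡ 1ℚ → inv a ≡ y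
inv-unique {a} {y} ay≡1 = begin
  inv a              ≡⟨ sym (ℚP.*-identityʳ (inv a)) ⟩
  inv a * 1ℚ         ≡⟨ cong (inv a *_) (sym ay≡1) ⟩
  inv a * (a * y)    ≡⟨ solve 3 (λ i a y → i :* (a :* y) := (a :* i) :* y) refl (inv a) a y ⟩
  (a * inv a) * y    ≡⟨ cong (_* y) (inv-inverseʳ a≢0) ⟩
  1ℚ * y             ≡⟨ ℚP.*-identityˡ y ⟩
  y                  ∎
  where
  open ≡-Reasoning
  a≢0 : a ≢ 0ℚ
  a≢0 refl with trans (sym ay≡1) (ℚP.*-zeroˡ y)
  ... | ()

inv-* : ∀ {c} x → c ≢ 0ℚ → inv (c * x) ≡ inv c * inv x
inv-* {c} x c≢0 = by-cases (x ℚP.≟ 0ℚ)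
  where
  open ≡-Reasoning
  by-cases : Dec (x ≡ 0ℚ) → inv (c * x) ≡ inv c * inv x
  by-cases (yes refl) = trans (cong inv (ℚP.*-zeroʳ c)) (sym (ℚP.*-zeroʳ (inv c)))
  by-cases (no x≢0) = inv-unique {c * x} (begin
    (c * x) * (inv c * inv x)  ≡⟨ solve 4 (λ c x i j → (c :* x) :* (i :* j) := (c :* i) :* (x :* j)) refl c x (inv c) (inv x) ⟩
    (c * inv c) * (x * inv x)  ≡⟨ cong₂ _*_ (inv-inverseʳ c≢0) (inv-inverseʳ x≢0) ⟩
    1ℚ                         ∎)

cong₃ : ∀ {A B C D : Set} (f : A → B → C → D) {x x′ y y′ z z′} → x ≡ x′ → y ≡ y′ → z ≡ z′ → f x y z ≡ f x′ y′ z′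
cong₃ f refl refl refl = refl

≡ᵇ-refl : ∀ m → (m ≡ᵇ m) ≡ true
≡ᵇ-refl zero = refl
≡ᵇ-refl (suc m) = ≡ᵇ-refl m

≡ᵇ-sym : ∀ m n → (m ≡ᵇ n) ≡ (n ≡ᵇ m)
≡ᵇ-sym zero zero = refl
≡ᵇ-sym zero (suc n) = refl
≡ᵇ-sym (suc m) zero = refl
≡ᵇ-sym (suc m) (suc n) = ≡ᵇ-sym m n

≡ᵇ-+ : ∀ c s t → (c ℕ.+ s ≡ᵇ c ℕ.+ t) ≡ (s ≡ᵇ t)
≡ᵇ-+ zero s t = refl
≡ᵇ-+ (suc c) s t = ≡ᵇ-+ c s t

≡ᵇ≡true⇒≡ : ∀ {m n} → (m ≡ᵇ n) ≡ true → m ≡ n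
≡ᵇ≡true⇒≡ {m} {n} eq = ℕP.≡ᵇ⇒≡ m n (Equivalence.from T-≡ eq)

≢⇒≡ᵇ≡false : ∀ {m n} → m ≢ n → (m ≡ᵇ n) ≡ false
≢⇒≡ᵇ≡false m≢n = ¬-not (m≢n ∘ ≡ᵇ≡true⇒≡)

<⇒<ᵇ≡true : ∀ {m n} → m < n → (m <ᵇ n) ≡ true
<⇒<ᵇ≡true m<n = Equivalence.to T-≡ (ℕP.<⇒<ᵇ m<n)

≤⇒<ᵇ≡false : ∀ {m n} → n ≤ m → (m <ᵇ n) ≡ false
≤⇒<ᵇ≡false {m} {n} n≤m = ¬-not (λ m<ᵇn → ℕP.<⇒≱ (ℕP.<ᵇ⇒< m n (Equivalence.from T-≡ m<ᵇn)) n≤m)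

∧-absorbs : ∀ {x y} → (x ≡ true → y ≡ true) → x ∧ y ≡ x
∧-absorbs {false} x⇒y = refl
∧-absorbs {true} x⇒y = x⇒y refl

∧-≡false : ∀ {x y} → (x ≡ true → y ≡ false) → x ∧ y ≡ false
∧-≡false {false} _ = refl
∧-≡false {true} x⇒¬y = x⇒¬y refl

∨-swap : ∀ x y w v → x ∨ y ∨ w ∨ v ≡ y ∨ x ∨ v ∨ w
∨-swap true true w v = refl
∨-swap true false w v = refl
∨-swap false true w v = refl
∨-swap false false w v = ∨-comm w v

ind : Bool → ℚ
ind b = if b then 1ℚ else 0ℚ

ind-∨ : ∀ {x y} → (x ≡ true → y ≡ false) → ind (x ∨ y) ≡ ind x + ind y
ind-∨ {false} {y} _ = sym (ℚP.+-identityˡ (ind y))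
ind-∨ {true} x⇒¬y rewrite x⇒¬y refl = refl

ind-<ᵇ-suc : ∀ i a → ind (i <ᵇ suc a) ≡ ind (i <ᵇ a) + ind (i ≡ᵇ a)
ind-<ᵇ-suc zero zero = refl
ind-<ᵇ-suc zero (suc a) = refl
ind-<ᵇ-suc (suc i) zero = refl
ind-<ᵇ-suc (suc i) (suc a) = ind-<ᵇ-suc i a

sumFin-cong : ∀ {N} {f g : Fin N → ℚ} → (∀ i → f i ≡ g i) → sumFin f ≡ sumFin g
sumFin-cong {zero} f≗g = refl
sumFin-cong {suc N} f≗g = cong₂ _+_ (f≗g Fin.zero) (sumFin-cong (f≗g ∘ Fin.suc))

sumFin-0 : ∀ {N} {f : Fin N → ℚ} → (∀ i → f i ≡ 0ℚ) → sumFin f ≡ 0ℚ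
sumFin-0 {zero} f≗0 = refl
sumFin-0 {suc N} f≗0 = cong₂ _+_ (f≗0 Fin.zero) (sumFin-0 (f≗0 ∘ Fin.suc))

sumFin-+ : ∀ {N} (f g : Fin N → ℚ) → sumFin (λ i → f i + g i) ≡ sumFin f + sumFin g
sumFin-+ {zero} f g = refl
sumFin-+ {suc N} f g = trans (cong ((f Fin.zero + g Fin.zero) +_) (sumFin-+ (f ∘ Fin.suc) (g ∘ Fin.suc)))
  (solve 4 (λ a b c d → (a :+ b) :+ (c :+ d) := (a :+ c) :+ (b :+ d)) refl
    (f Fin.zero) (g Fin.zero) (sumFin (f ∘ Fin.suc)) (sumFin (g ∘ Fin.suc)))

sumFin-- : ∀ {N} (f g : Fin N → ℚ) → sumFin (λ i → f i - g i) ≡ sumFin f - sumFin g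
sumFin-- {zero} f g = refl
sumFin-- {suc N} f g = trans (cong ((f Fin.zero - g Fin.zero) +_) (sumFin-- (f ∘ Fin.suc) (g ∘ Fin.suc)))
  (solve 4 (λ a b c d → (a :- b) :+ (c :- d) := (a :+ c) :- (b :+ d)) refl
    (f Fin.zero) (g Fin.zero) (sumFin (f ∘ Fin.suc)) (sumFin (g ∘ Fin.suc)))

sumFin-*ˡ : ∀ {N} c (f : Fin N → ℚ) → sumFin (λ i → c * f i) ≡ c * sumFin f
sumFin-*ˡ {zero} c f = sym (ℚP.*-zeroʳ c)
sumFin-*ˡ {suc N} c f = trans (cong (c * f Fin.zero +_) (sumFin-*ˡ c (f ∘ Fin.suc)))
  (sym (ℚP.*-distribˡ-+ c (f Fin.zero) (sumFin (f ∘ Fin.suc))))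

sumFin-swap : ∀ {M N} (F : Fin M → Fin N → ℚ) →
  sumFin (λ i → sumFin (λ j → F i j)) ≡ sumFin (λ j → sumFin (λ i → F i j))
sumFin-swap {zero} {N} F = sym (sumFin-0 {N} (λ _ → refl))
sumFin-swap {suc M} F = trans (cong (sumFin (F Fin.zero) +_) (sumFin-swap (F ∘ Fin.suc)))
  (sym (sumFin-+ (F Fin.zero) (λ j → sumFin (λ i → F (Fin.suc i) j))))

sumFin-sift : ∀ {N} (f : Fin N → ℚ) i → sumFin (λ k → f k * e i k) ≡ f i
sumFin-sift f Fin.zero = trans (cong₂ _+_ (ℚP.*-identityʳ (f Fin.zero)) (sumFin-0 (λ k → ℚP.*-zeroʳ (f (Fin.suc k)))))
  (ℚP.+-identityʳ (f Fin.zero))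
sumFin-sift f (Fin.suc i) = trans (cong₂ _+_ (ℚP.*-zeroʳ (f Fin.zero)) (sumFin-sift (f ∘ Fin.suc) i))
  (ℚP.+-identityˡ (f (Fin.suc i)))

sumFin-dipole : ∀ {N} (f : Fin N → ℚ) i j → sumFin (λ k → f k * (e i k - e j k)) ≡ f i - f j
sumFin-dipole f i j = begin
  sumFin (λ k → f k * (e i k - e j k))                       ≡⟨ sumFin-cong (λ k → x[y-z]≈xy-xz (f k) (e i k) (e j k)) ⟩
  sumFin (λ k → f k * e i k - f k * e j k)                   ≡⟨ sumFin-- (λ k → f k * e i k) (λ k → f k * e j k) ⟩
  sumFin (λ k → f k * e i k) - sumFin (λ k → f k * e j k)   ≡⟨ cong₂ _-_ (sumFin-sift f i) (sumFin-sift f j) ⟩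
  f i - f j                                                  ∎
  where open ≡-Reasoning

sumBelow : ℕ → (ℕ → ℚ) → ℚ
sumBelow n f = sumFin {n} (λ i → f (toℕ i))

sumBelow-cong : ∀ n {f g : ℕ → ℚ} → (∀ a → a < n → f a ≡ g a) → sumBelow n f ≡ sumBelow n g
sumBelow-cong n f≗g = sumFin-cong (λ i → f≗g (toℕ i) (toℕ<n i))

sumBelow-+ : ∀ n (f g : ℕ → ℚ) → sumBelow n (λ a → f a + g a) ≡ sumBelow n f + sumBelow n g
sumBelow-+ n f g = sumFin-+ {n} (f ∘ toℕ) (g ∘ toℕ)

sumBelow-*ˡ : ∀ n c (f : ℕ → ℚ) → sumBelow n (λ a → c * f a) ≡ c * sumBelow n f
sumBelow-*ˡ n c f = sumFin-*ˡ {n} c (f ∘ toℕ)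

sumBelow-0 : ∀ n {f : ℕ → ℚ} → (∀ a → a < n → f a ≡ 0ℚ) → sumBelow n f ≡ 0ℚ
sumBelow-0 n f≗0 = trans (sumBelow-cong n f≗0) (sumFin-0 {n} (λ _ → refl))

sumBelow-const : ∀ n c → sumBelow n (λ _ → c) ≡ ℕ→ℚ n * c
sumBelow-const zero c = sym (ℚP.*-zeroˡ c)
sumBelow-const (suc n) c = begin
  c + sumBelow n (λ _ → c)  ≡⟨ cong (c +_) (sumBelow-const n c) ⟩
  c + ℕ→ℚ n * c             ≡⟨ solve 2 (λ c x → c :+ x :* c := (con 1ℚ :+ x) :* c) refl c (ℕ→ℚ n) ⟩
  (1ℚ + ℕ→ℚ n) * c          ≡⟨ cong (_* c) (sym (ℕ→ℚ-suc n)) ⟩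
  ℕ→ℚ (suc n) * c           ∎
  where open ≡-Reasoning

sumBelow-split : ∀ m n (f : ℕ → ℚ) → sumBelow (m ℕ.+ n) f ≡ sumBelow m f + sumBelow n (λ a → f (m ℕ.+ a))
sumBelow-split zero n f = sym (ℚP.+-identityˡ _)
sumBelow-split (suc m) n f = trans (cong (f 0 +_) (sumBelow-split m n (f ∘ suc)))
  (sym (ℚP.+-assoc (f 0) (sumBelow m (f ∘ suc)) (sumBelow n (λ a → f (suc m ℕ.+ a)))))

sumBelow-suc : ∀ n (f : ℕ → ℚ) → sumBelow (suc n) f ≡ sumBelow n f + f n
sumBelow-suc zero f = trans (ℚP.+-identityʳ (f 0)) (sym (ℚP.+-identityˡ (f 0)))
sumBelow-suc (suc n) f = trans (cong (f 0 +_) (sumBelow-suc n (f ∘ suc)))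
  (sym (ℚP.+-assoc (f 0) (sumBelow n (f ∘ suc)) (f (suc n))))

sumBelow-sift : ∀ {n t} (f : ℕ → ℚ) → t < n → sumBelow n (λ b → ind (t ≡ᵇ b) * f b) ≡ f t
sumBelow-sift {suc n} {zero} f _ =
  trans (cong₂ _+_ (ℚP.*-identityˡ (f 0)) (sumFin-0 {n} (λ b → ℚP.*-zeroˡ (f (suc (toℕ b)))))) (ℚP.+-identityʳ (f 0))
sumBelow-sift {suc n} {suc t} f (s≤s t<n) =
  trans (cong₂ _+_ (ℚP.*-zeroˡ (f 0)) (sumBelow-sift (f ∘ suc) t<n)) (ℚP.+-identityˡ (f (suc t)))

prev : ℕ → (ℕ → ℚ) → ℚ
prev zero f = 0ℚ
prev (suc a) f = f a

prev-cong : ∀ a {f g : ℕ → ℚ} → (∀ b → suc b ≡ a → f b ≡ g b) → prev a f ≡ prev a g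
prev-cong zero f≗g = refl
prev-cong (suc a) f≗g = f≗g a refl

prev-zero : ∀ a → prev a (λ _ → 0ℚ) ≡ 0ℚ
prev-zero zero = refl
prev-zero (suc a) = refl

sumBelow-sift-prev : ∀ {m a} (f : ℕ → ℚ) → a ≤ m → sumBelow m (λ b → ind (suc b ≡ᵇ a) * f b) ≡ prev a f
sumBelow-sift-prev {m} {zero} f _ = sumFin-0 {m} (λ b → ℚP.*-zeroˡ (f (toℕ b)))
sumBelow-sift-prev {m} {suc a} f a<m = trans (sumBelow-cong m (λ b _ → cong (λ x → ind x * f b) (≡ᵇ-sym b a)))
  (sumBelow-sift f a<m)

-- Laplacians and grounded potentials

IsSymmetric : ∀ {N} → Adj N → Set
IsSymmetric A = ∀ i j → A i j ≡ A j i

module _ {N} (A : Adj N) where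

  lap-- : ∀ (f g : Fin N → ℚ) a → lap A (λ k → f k - g k) a ≡ lap A f a - lap A g a
  lap-- f g a = begin
    deg A a * (f a - g a) - sumFin (λ j → A a j * (f j - g j))
      ≡⟨ cong (deg A a * (f a - g a) -_) (trans (sumFin-cong (λ j → x[y-z]≈xy-xz (A a j) (f j) (g j)))
                                                (sumFin-- (λ j → A a j * f j) (λ j → A a j * g j))) ⟩
    deg A a * (f a - g a) - (sumFin (λ j → A a j * f j) - sumFin (λ j → A a j * g j))
      ≡⟨ solve 5 (λ d x y s t → d :* (x :- y) :- (s :- t) := (d :* x :- s) :- (d :* y :- t)) refl
           (deg A a) (f a) (g a) (sumFin (λ j → A a j * f j)) (sumFin (λ j → A a j * g j)) ⟩
    lap A f a - lap A g a
      ∎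
    where open ≡-Reasoning

  lap-pairing : ∀ (x y : Fin N → ℚ) → sumFin (λ k → y k * lap A x k)
    ≡ sumFin (λ k → y k * deg A k * x k) - sumFin (λ k → sumFin (λ j → y k * A k j * x j))
  lap-pairing x y = begin
    sumFin (λ k → y k * lap A x k)
      ≡⟨ sumFin-cong (λ k → trans (x[y-z]≈xy-xz (y k) _ _) (cong₂ _-_ (sym (ℚP.*-assoc (y k) _ _)) (inner k))) ⟩
    sumFin (λ k → y k * deg A k * x k - sumFin (λ j → y k * A k j * x j))
      ≡⟨ sumFin-- (λ k → y k * deg A k * x k) (λ k → sumFin (λ j → y k * A k j * x j)) ⟩
    sumFin (λ k → y k * deg A k * x k) - sumFin (λ k → sumFin (λ j → y k * A k j * x j))
      ∎
    where
    open ≡-Reasoning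
    inner : ∀ k → y k * sumFin (λ j → A k j * x j) ≡ sumFin (λ j → y k * A k j * x j)
    inner k = trans (sym (sumFin-*ˡ (y k) (λ j → A k j * x j))) (sumFin-cong (λ j → sym (ℚP.*-assoc (y k) (A k j) (x j))))

  lap-selfAdjoint : IsSymmetric A → ∀ (x y : Fin N → ℚ) →
    sumFin (λ k → y k * lap A x k) ≡ sumFin (λ k → x k * lap A y k)
  lap-selfAdjoint A-sym x y = begin
    sumFin (λ k → y k * lap A x k)
      ≡⟨ lap-pairing x y ⟩
    sumFin (λ k → y k * deg A k * x k) - sumFin (λ k → sumFin (λ j → y k * A k j * x j))
      ≡⟨ cong₂ _-_ (sumFin-cong (λ k → swap₃ (y k) (deg A k) (x k))) adjacency-term ⟩
    sumFin (λ k → x k * deg A k * y k) - sumFin (λ k → sumFin (λ j → x k * A k j * y j))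
      ≡⟨ sym (lap-pairing y x) ⟩
    sumFin (λ k → x k * lap A y k)
      ∎
    where
    open ≡-Reasoning
    swap₃ : ∀ a b c → a * b * c ≡ c * b * a
    swap₃ = solve 3 (λ a b c → a :* b :* c := c :* b :* a) refl
    adjacency-term : sumFin (λ k → sumFin (λ j → y k * A k j * x j)) ≡ sumFin (λ k → sumFin (λ j → x k * A k j * y j))
    adjacency-term = trans (sumFin-swap (λ k j → y k * A k j * x j))
      (sumFin-cong (λ j → sumFin-cong (λ k → trans (cong (λ a → y k * a * x j) (A-sym k j)) (swap₃ (y k) (A j k) (x j)))))

  potential-drop-unique : IsSymmetric A → ∀ {i j} (x y : Fin N → ℚ) →
    (∀ k → lap A x k ≡ e i k - e j k) → (∀ k → lap A y k ≡ e i k - e j k) → x i - x j ≡ y i - y j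
  potential-drop-unique A-sym {i} {j} x y Lx Ly = begin
    x i - x j                               ≡⟨ sym (sumFin-dipole x i j) ⟩
    sumFin (λ k → x k * (e i k - e j k))    ≡⟨ sumFin-cong (λ k → cong (x k *_) (sym (Ly k))) ⟩
    sumFin (λ k → x k * lap A y k)          ≡⟨ sym (lap-selfAdjoint A-sym x y) ⟩
    sumFin (λ k → y k * lap A x k)          ≡⟨ sumFin-cong (λ k → cong (y k *_) (Lx k)) ⟩
    sumFin (λ k → y k * (e i k - e j k))    ≡⟨ sumFin-dipole y i j ⟩
    y i - y j                               ∎
    where open ≡-Reasoning

  kemeny-unique : IsSymmetric A → ∀ {P Q} → IsPotentials A P → IsPotentials A Q → kemeny A P ≡ kemeny A Q
  kemeny-unique A-sym {P} {Q} P-pot Q-pot = cong (inv (ℕ→ℚ 4 * edges A) *_)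
    (sumFin-cong λ i → sumFin-cong λ j → cong (deg A i * deg A j *_)
      (potential-drop-unique A-sym (P i j) (Q i j) (P-pot i j) (Q-pot i j)))

vol : ∀ {N} → Adj N → ℚ
vol A = sumFin (deg A)

module GroundedPotentials {N} (A : Adj N) (g : Fin N) (U : Fin N → Fin N → ℚ)
  (lap-U : ∀ i k → lap A (U i) k ≡ e i k - e g k) where

  potentials : Fin N → Fin N → Fin N → ℚ
  potentials i j k = U i k - U j k

  potentials-isPotentials : IsPotentials A potentials
  potentials-isPotentials i j k = begin
    lap A (λ k → U i k - U j k) k            ≡⟨ lap-- A (U i) (U j) k ⟩
    lap A (U i) k - lap A (U j) k            ≡⟨ cong₂ _-_ (lap-U i k) (lap-U j k) ⟩
    (e i k - e g k) - (e j k - e g k)        ≡⟨ solve 3 (λ a b c → (a :- c) :- (b :- c) := a :- b) refl (e i k) (e j k) (e g k) ⟩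
    e i k - e j k                            ∎
    where open ≡-Reasoning

  module _ (A-sym : IsSymmetric A) (U-g : ∀ i → U i g ≡ 0ℚ)
    (z : Fin N → ℚ) (lap-z : ∀ k → lap A z k ≡ deg A k - vol A * e g k) where

    degree-weighted-U : ∀ a → sumFin (λ b → deg A b * U a b) ≡ z a - z g
    degree-weighted-U a = begin
      sumFin (λ b → deg A b * U a b)
        ≡⟨ sumFin-cong split-degree ⟩
      sumFin (λ b → U a b * lap A z b + vol A * (U a b * e g b))
        ≡⟨ trans (sumFin-+ (λ b → U a b * lap A z b) (λ b → vol A * (U a b * e g b)))
             (cong (sumFin (λ b → U a b * lap A z b) +_) (sumFin-*ˡ (vol A) (λ b → U a b * e g b))) ⟩
      sumFin (λ b → U a b * lap A z b) + vol A * sumFin (λ b → U a b * e g b)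
        ≡⟨ cong₂ (λ s t → s + vol A * t) (lap-selfAdjoint A A-sym z (U a)) (trans (sumFin-sift (U a) g) (U-g a)) ⟩
      sumFin (λ b → z b * lap A (U a) b) + vol A * 0ℚ
        ≡⟨ cong₂ (λ s t → s + t) (trans (sumFin-cong (λ b → cong (z b *_) (lap-U a b))) (sumFin-dipole z a g)) (ℚP.*-zeroʳ (vol A)) ⟩
      (z a - z g) + 0ℚ
        ≡⟨ ℚP.+-identityʳ (z a - z g) ⟩
      z a - z g
        ∎
      where
      open ≡-Reasoning
      split-degree : ∀ b → deg A b * U a b ≡ U a b * lap A z b + vol A * (U a b * e g b)
      split-degree b rewrite lap-z b =
        solve 4 (λ d u v ε → d :* u := u :* (d :- v :* ε) :+ v :* (u :* ε)) refl (deg A b) (U a b) (vol A) (e g b)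

    weighted-drop : ∀ a → sumFin (λ b → deg A a * deg A b * (U a a - U a b)) ≡ deg A a * (U a a * vol A - (z a - z g))
    weighted-drop a = begin
      sumFin (λ b → deg A a * deg A b * (U a a - U a b))
        ≡⟨ sumFin-cong (λ b → expand (deg A a) (deg A b) (U a a) (U a b)) ⟩
      sumFin (λ b → (deg A a * U a a) * deg A b - deg A a * (deg A b * U a b))
        ≡⟨ sumFin-- (λ b → (deg A a * U a a) * deg A b) (λ b → deg A a * (deg A b * U a b)) ⟩
      sumFin (λ b → (deg A a * U a a) * deg A b) - sumFin (λ b → deg A a * (deg A b * U a b))
        ≡⟨ cong₂ _-_ (sumFin-*ˡ (deg A a * U a a) (deg A))
                     (trans (sumFin-*ˡ (deg A a) (λ b → deg A b * U a b)) (cong (deg A a *_) (degree-weighted-U a))) ⟩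
      (deg A a * U a a) * vol A - deg A a * (z a - z g)
        ≡⟨ solve 4 (λ d u v w → (d :* u) :* v :- d :* w := d :* (u :* v :- w)) refl (deg A a) (U a a) (vol A) (z a - z g) ⟩
      deg A a * (U a a * vol A - (z a - z g))
        ∎
      where
      open ≡-Reasoning
      expand : ∀ da db u v → da * db * (u - v) ≡ (da * u) * db - da * (db * v)
      expand = solve 4 (λ da db u v → da :* db :* (u :- v) := (da :* u) :* db :- da :* (db :* v)) refl

    resistance-sum : sumFin (λ a → sumFin (λ b → deg A a * deg A b * resistance potentials a b))
      ≡ sumFin (λ a → deg A a * (U a a * vol A - (z a - z g))) + sumFin (λ a → deg A a * (U a a * vol A - (z a - z g)))
    resistance-sum = begin
      sumFin (λ a → sumFin (λ b → deg A a * deg A b * resistance potentials a b))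
        ≡⟨ sumFin-cong (λ a → sumFin-cong (λ b → split (deg A a) (deg A b) (U a a) (U b a) (U a b) (U b b))) ⟩
      sumFin (λ a → sumFin (λ b → F a b + F b a))
        ≡⟨ trans (sumFin-cong (λ a → sumFin-+ (F a) (λ b → F b a))) (sumFin-+ (λ a → sumFin (F a)) (λ a → sumFin (λ b → F b a))) ⟩
      sumFin (λ a → sumFin (F a)) + sumFin (λ a → sumFin (λ b → F b a))
        ≡⟨ cong (sumFin (λ a → sumFin (F a)) +_) (sumFin-swap (λ a b → F b a)) ⟩
      sumFin (λ a → sumFin (F a)) + sumFin (λ a → sumFin (F a))
        ≡⟨ cong (λ s → s + s) (sumFin-cong weighted-drop) ⟩
      sumFin (λ a → deg A a * (U a a * vol A - (z a - z g))) + sumFin (λ a → deg A a * (U a a * vol A - (z a - z g)))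
        ∎
      where
      open ≡-Reasoning
      F : Fin N → Fin N → ℚ
      F a b = deg A a * deg A b * (U a a - U a b)
      split : ∀ da db uaa uba uab ubb →
        da * db * ((uaa - uba) - (uab - ubb)) ≡ da * db * (uaa - uab) + db * da * (ubb - uba)
      split = solve 6 (λ da db uaa uba uab ubb →
        da :* db :* ((uaa :- uba) :- (uab :- ubb)) := da :* db :* (uaa :- uab) :+ db :* da :* (ubb :- uba)) refl

-- Sums along a path

prev-monus : ∀ q {i} → i ≤ q → prev q (λ b → ℕ→ℚ (q ∸ (i ⊔ b))) ≡ 1ℚ - ind (i ≡ᵇ q)
prev-monus zero z≤n = refl
prev-monus (suc q) {i} i≤q+1 with ℕP.m≤n⇒m<n∨m≡n i≤q+1
... | inj₁ (s≤s i≤q) rewrite ℕP.m≤n⇒m⊔n≡n i≤q | ℕP.+-∸-assoc 1 (ℕP.≤-refl {q}) | ℕP.n∸n≡0 q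
                           | ≢⇒≡ᵇ≡false (ℕP.<⇒≢ (s≤s i≤q)) = refl
... | inj₂ refl rewrite ℕP.m≥n⇒m⊔n≡m (ℕP.n≤1+n q) | ℕP.n∸n≡0 q | ≡ᵇ-refl q = refl

prev-squares : ∀ q → prev q (λ b → ℕ→ℚ q * ℕ→ℚ q - ℕ→ℚ b * ℕ→ℚ b) ≡ (ℕ→ℚ q + ℕ→ℚ q) - prev q (λ _ → 1ℚ)
prev-squares zero = refl
prev-squares (suc q) rewrite ℕ→ℚ-suc q =
  solve 1 (λ x → (con 1ℚ :+ x) :* (con 1ℚ :+ x) :- x :* x := ((con 1ℚ :+ x) :+ (con 1ℚ :+ x)) :- con 1ℚ) refl (ℕ→ℚ q)

sumBelow-pathDegree : ∀ q → sumBelow q (λ a → 1ℚ + prev a (λ _ → 1ℚ)) ≡ (ℕ→ℚ q + ℕ→ℚ q) - prev q (λ _ → 1ℚ)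
sumBelow-pathDegree zero = refl
sumBelow-pathDegree (suc q) = begin
  (1ℚ + 0ℚ) + sumBelow q (λ _ → 1ℚ + 1ℚ)  ≡⟨ cong ((1ℚ + 0ℚ) +_) (sumBelow-const q (1ℚ + 1ℚ)) ⟩
  (1ℚ + 0ℚ) + ℕ→ℚ q * (1ℚ + 1ℚ)          ≡⟨ solve 1 (λ x → (con 1ℚ :+ con 0ℚ) :+ x :* (con 1ℚ :+ con 1ℚ)
                                                        := ((con 1ℚ :+ x) :+ (con 1ℚ :+ x)) :- con 1ℚ) refl (ℕ→ℚ q) ⟩
  ((1ℚ + ℕ→ℚ q) + (1ℚ + ℕ→ℚ q)) - 1ℚ      ≡⟨ cong (λ x → (x + x) - 1ℚ) (sym (ℕ→ℚ-suc q)) ⟩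
  (ℕ→ℚ (suc q) + ℕ→ℚ (suc q)) - 1ℚ        ∎
  where open ≡-Reasoning

third : ℚ
third = ℤ.+ 1 / 3

pathTerm : ℚ → ℕ → ℕ → ℚ
pathTerm V q a = (1ℚ + prev a (λ _ → 1ℚ)) * ((ℕ→ℚ q - ℕ→ℚ a) * V - (ℕ→ℚ q * ℕ→ℚ q - ℕ→ℚ a * ℕ→ℚ a))

pathTerm-suc : ∀ V q a → pathTerm V (suc q) a ≡ pathTerm V q a + (V - (1ℚ + (ℕ→ℚ q + ℕ→ℚ q))) * (1ℚ + prev a (λ _ → 1ℚ))
pathTerm-suc V q a rewrite ℕ→ℚ-suc q =
  solve 4 (λ V Q A d → (con 1ℚ :+ d) :* (((con 1ℚ :+ Q) :- A) :* V :- ((con 1ℚ :+ Q) :* (con 1ℚ :+ Q) :- A :* A))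
                     := (con 1ℚ :+ d) :* ((Q :- A) :* V :- (Q :* Q :- A :* A)) :+ (V :- (con 1ℚ :+ (Q :+ Q))) :* (con 1ℚ :+ d))
    refl V (ℕ→ℚ q) (ℕ→ℚ a) (prev a (λ _ → 1ℚ))

pathTerm-diag : ∀ V q → pathTerm V q q ≡ 0ℚ
pathTerm-diag V q = solve 3 (λ V Q d → (con 1ℚ :+ d) :* ((Q :- Q) :* V :- (Q :* Q :- Q :* Q)) := con 0ℚ) refl
  V (ℕ→ℚ q) (prev q (λ _ → 1ℚ))

sumBelow-pathTerm : ∀ V q →
  sumBelow q (pathTerm V q) ≡ V * ℕ→ℚ q * ℕ→ℚ q - third * (ℕ→ℚ 4 * (ℕ→ℚ q * ℕ→ℚ q * ℕ→ℚ q) - ℕ→ℚ q)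
sumBelow-pathTerm V zero =
  solve 1 (λ V → con 0ℚ := V :* con 0ℚ :* con 0ℚ :- con third :* (con (ℕ→ℚ 4) :* (con 0ℚ :* con 0ℚ :* con 0ℚ) :- con 0ℚ))
    refl V
sumBelow-pathTerm V (suc q) = begin
  sumBelow (suc q) (pathTerm V (suc q))
    ≡⟨ sumBelow-cong (suc q) (λ a _ → pathTerm-suc V q a) ⟩
  sumBelow (suc q) (λ a → pathTerm V q a + c * (1ℚ + prev a (λ _ → 1ℚ)))
    ≡⟨ sumBelow-+ (suc q) (pathTerm V q) (λ a → c * (1ℚ + prev a (λ _ → 1ℚ))) ⟩
  sumBelow (suc q) (pathTerm V q) + sumBelow (suc q) (λ a → c * (1ℚ + prev a (λ _ → 1ℚ)))
    ≡⟨ cong₂ _+_ (sumBelow-suc q (pathTerm V q)) (sumBelow-*ˡ (suc q) c (λ a → 1ℚ + prev a (λ _ → 1ℚ))) ⟩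
  (sumBelow q (pathTerm V q) + pathTerm V q q) + c * sumBelow (suc q) (λ a → 1ℚ + prev a (λ _ → 1ℚ))
    ≡⟨ cong₂ (λ s t → s + c * t) (cong₂ _+_ (sumBelow-pathTerm V q) (pathTerm-diag V q)) (sumBelow-pathDegree (suc q)) ⟩
  (V * Q * Q - third * (ℕ→ℚ 4 * (Q * Q * Q) - Q) + 0ℚ) + c * ((ℕ→ℚ (suc q) + ℕ→ℚ (suc q)) - 1ℚ)
    ≡⟨ cong (λ x → (V * Q * Q - third * (ℕ→ℚ 4 * (Q * Q * Q) - Q) + 0ℚ) + c * ((x + x) - 1ℚ)) (ℕ→ℚ-suc q) ⟩
  (V * Q * Q - third * (ℕ→ℚ 4 * (Q * Q * Q) - Q) + 0ℚ) + c * (((1ℚ + Q) + (1ℚ + Q)) - 1ℚ)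
    ≡⟨ solve 2 (λ V Q → (V :* Q :* Q :- con third :* (con (ℕ→ℚ 4) :* (Q :* Q :* Q) :- Q) :+ con 0ℚ)
                        :+ (V :- (con 1ℚ :+ (Q :+ Q))) :* (((con 1ℚ :+ Q) :+ (con 1ℚ :+ Q)) :- con 1ℚ)
                      := V :* (con 1ℚ :+ Q) :* (con 1ℚ :+ Q)
                         :- con third :* (con (ℕ→ℚ 4) :* ((con 1ℚ :+ Q) :* (con 1ℚ :+ Q) :* (con 1ℚ :+ Q)) :- (con 1ℚ :+ Q))) refl V Q ⟩
  V * (1ℚ + Q) * (1ℚ + Q) - third * (ℕ→ℚ 4 * ((1ℚ + Q) * (1ℚ + Q) * (1ℚ + Q)) - (1ℚ + Q))
    ≡⟨ cong (λ x → V * x * x - third * (ℕ→ℚ 4 * (x * x * x) - x)) (sym (ℕ→ℚ-suc q)) ⟩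
  V * ℕ→ℚ (suc q) * ℕ→ℚ (suc q) - third * (ℕ→ℚ 4 * (ℕ→ℚ (suc q) * ℕ→ℚ (suc q) * ℕ→ℚ (suc q)) - ℕ→ℚ (suc q))
    ∎
  where
  open ≡-Reasoning
  Q c : ℚ
  Q = ℕ→ℚ q
  c = V - (1ℚ + (Q + Q))

-- The dandelion

dandelion-symmetric : ∀ n l → IsSymmetric (dandelion n l)
dandelion-symmetric n l i j = cong ind (dandelionAdjᵇ-sym l (toℕ i) (toℕ j))
  where
  dandelionAdjᵇ-sym : ∀ l a b → dandelionAdjᵇ l a b ≡ dandelionAdjᵇ l b a
  dandelionAdjᵇ-sym l a b = ∨-swap ((suc a ≡ᵇ b) ∧ (b <ᵇ l)) ((suc b ≡ᵇ a) ∧ (a <ᵇ l))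
    ((a ≡ᵇ l ∸ 1) ∧ (l ∸ 1 <ᵇ b)) ((b ≡ᵇ l ∸ 1) ∧ (l ∸ 1 <ᵇ a))

kemenyFormula : ℚ → ℚ → ℚ → ℚ
kemenyFormula N⁺ N L = (N⁺ * (ℕ→ℚ 2 * L * L - 1ℚ) + ℕ→ℚ 2 * N * (N - ℕ→ℚ 3 * L)) * inv (ℕ→ℚ 2 * (N - 1ℚ))
  + (L * (ℕ→ℚ 5 - ℕ→ℚ 2 * L * L)) * inv (ℕ→ℚ 3 * (N - 1ℚ))

dandelionKemeny-formula : ∀ n l → dandelionKemeny n l ≡ kemenyFormula (ℕ→ℚ (suc n)) (ℕ→ℚ n) (ℕ→ℚ l)
dandelionKemeny-formula n l = refl

-- Here l = suc p: vertex p is the centre, 0 … p − 1 is the rest of the path and the k vertices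
-- above p are the leaves.
module Dandelion (p k : ℕ) where

  n : ℕ
  n = suc p ℕ.+ k

  adj : ℕ → ℕ → ℚ
  adj a b = ind (dandelionAdjᵇ (suc p) a b)

  degree : ℕ → ℚ
  degree a = sumBelow n (adj a)

  lapℕ : (ℕ → ℚ) → ℕ → ℚ
  lapℕ f a = degree a * f a - sumBelow n (λ b → adj a b * f b)

  lap-dandelion : ∀ (f : ℕ → ℚ) i → lap (dandelion n (suc p)) (λ j → f (toℕ j)) i ≡ lapℕ f (toℕ i)
  lap-dandelion f i = refl

  adjᵇ-path : ∀ {a} b → a < p → dandelionAdjᵇ (suc p) a b ≡ (suc a ≡ᵇ b) ∨ (suc b ≡ᵇ a)
  adjᵇ-path {a} b a<p
    rewrite <⇒<ᵇ≡true (ℕP.m<n⇒m<1+n a<p) | ≢⇒≡ᵇ≡false (ℕP.<⇒≢ a<p) | ≤⇒<ᵇ≡false (ℕP.<⇒≤ a<p)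
          | ∧-absorbs {suc a ≡ᵇ b} {b <ᵇ suc p}
              (λ eq → <⇒<ᵇ≡true (subst (_< suc p) (≡ᵇ≡true⇒≡ {suc a} {b} eq) (s≤s a<p)))
          | ∧-identityʳ (suc b ≡ᵇ a) | ∧-zeroʳ (b ≡ᵇ p) | ∨-identityʳ (suc b ≡ᵇ a)
    = refl

  adjᵇ-centre : ∀ b → dandelionAdjᵇ (suc p) p b ≡ (suc b ≡ᵇ p) ∨ (p <ᵇ b)
  adjᵇ-centre b
    rewrite ∧-≡false {suc p ≡ᵇ b} {b <ᵇ suc p} (λ eq → ≤⇒<ᵇ≡false (ℕP.≤-reflexive (≡ᵇ≡true⇒≡ {suc p} {b} eq)))
          | <⇒<ᵇ≡true (ℕP.n<1+n p) | ≡ᵇ-refl p | ≤⇒<ᵇ≡false (ℕP.≤-refl {p})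
          | ∧-identityʳ (suc b ≡ᵇ p) | ∧-zeroʳ (b ≡ᵇ p) | ∨-identityʳ (p <ᵇ b)
    = refl

  adjᵇ-leaf : ∀ {a} b → p < a → dandelionAdjᵇ (suc p) a b ≡ (b ≡ᵇ p)
  adjᵇ-leaf {a} b p<a
    rewrite ∧-≡false {suc a ≡ᵇ b} {b <ᵇ suc p}
              (λ eq → ≤⇒<ᵇ≡false (ℕP.≤-trans p<a (ℕP.≤-trans (ℕP.n≤1+n a) (ℕP.≤-reflexive (≡ᵇ≡true⇒≡ {suc a} {b} eq)))))
          | ≤⇒<ᵇ≡false p<a | ≢⇒≡ᵇ≡false (ℕP.>⇒≢ p<a) | <⇒<ᵇ≡true p<a
          | ∧-zeroʳ (suc b ≡ᵇ a) | ∧-identityʳ (b ≡ᵇ p)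
    = refl

  p<n : p < n
  p<n = s≤s (ℕP.m≤m+n p k)

  p<leaf : ∀ t → p < suc p ℕ.+ t
  p<leaf t = s≤s (ℕP.m≤m+n p t)

  sumBelow-vertices : ∀ (f : ℕ → ℚ) → sumBelow n f ≡ (sumBelow p f + f p) + sumBelow k (λ t → f (suc p ℕ.+ t))
  sumBelow-vertices f = trans (sumBelow-split (suc p) k f) (cong (_+ sumBelow k (λ t → f (suc p ℕ.+ t))) (sumBelow-suc p f))

  sumBelow-leaves : ∀ (f : ℕ → ℚ) → sumBelow n (λ b → ind (p <ᵇ b) * f b) ≡ sumBelow k (λ t → f (suc p ℕ.+ t))
  sumBelow-leaves f = begin
    sumBelow n (λ b → ind (p <ᵇ b) * f b)
      ≡⟨ sumBelow-split (suc p) k (λ b → ind (p <ᵇ b) * f b) ⟩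
    sumBelow (suc p) (λ b → ind (p <ᵇ b) * f b) + sumBelow k (λ t → ind (p <ᵇ suc p ℕ.+ t) * f (suc p ℕ.+ t))
      ≡⟨ cong₂ _+_ (sumBelow-0 (suc p) centreAndPath) (sumBelow-cong k (λ t _ → leaf t)) ⟩
    0ℚ + sumBelow k (λ t → f (suc p ℕ.+ t))
      ≡⟨ ℚP.+-identityˡ _ ⟩
    sumBelow k (λ t → f (suc p ℕ.+ t))
      ∎
    where
    open ≡-Reasoning
    centreAndPath : ∀ b → b < suc p → ind (p <ᵇ b) * f b ≡ 0ℚ
    centreAndPath b b<p+1 rewrite ≤⇒<ᵇ≡false (ℕP.<⇒≤pred b<p+1) = ℚP.*-zeroˡ (f b)
    leaf : ∀ t → ind (p <ᵇ suc p ℕ.+ t) * f (suc p ℕ.+ t) ≡ f (suc p ℕ.+ t)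
    leaf t rewrite <⇒<ᵇ≡true (p<leaf t) = ℚP.*-identityˡ (f (suc p ℕ.+ t))

  adj-path : ∀ {a} → a < p → ∀ b → adj a b ≡ ind (suc a ≡ᵇ b) + ind (suc b ≡ᵇ a)
  adj-path {a} a<p b = trans (cong ind (adjᵇ-path b a<p)) (ind-∨ (λ a+1≡b →
    ≢⇒≡ᵇ≡false (λ b+1≡a → ℕP.<-asym (ℕP.≤-reflexive (≡ᵇ≡true⇒≡ {suc a} a+1≡b)) (ℕP.≤-reflexive b+1≡a))))

  adj-centre : ∀ b → adj p b ≡ ind (suc b ≡ᵇ p) + ind (p <ᵇ b)
  adj-centre b = trans (cong ind (adjᵇ-centre b)) (ind-∨ (λ b+1≡p →
    ≤⇒<ᵇ≡false (ℕP.<⇒≤ (ℕP.≤-reflexive (≡ᵇ≡true⇒≡ {suc b} b+1≡p)))))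

  adj-leaf : ∀ {a} → p < a → ∀ b → adj a b ≡ ind (p ≡ᵇ b)
  adj-leaf p<a b = cong ind (trans (adjᵇ-leaf b p<a) (≡ᵇ-sym b p))

  neighbours-split : ∀ {a} (x y : ℕ → Bool) → (∀ b → adj a b ≡ ind (x b) + ind (y b)) → ∀ (f : ℕ → ℚ) →
    sumBelow n (λ b → adj a b * f b) ≡ sumBelow n (λ b → ind (x b) * f b) + sumBelow n (λ b → ind (y b) * f b)
  neighbours-split x y adj≡ f =
    trans (sumBelow-cong n (λ b _ → trans (cong (_* f b) (adj≡ b)) (ℚP.*-distribʳ-+ (f b) (ind (x b)) (ind (y b)))))
          (sumBelow-+ n (λ b → ind (x b) * f b) (λ b → ind (y b) * f b))

  neighbours-path : ∀ {a} → a < p → ∀ f → sumBelow n (λ b → adj a b * f b) ≡ f (suc a) + prev a f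
  neighbours-path {a} a<p f = trans (neighbours-split (λ b → suc a ≡ᵇ b) (λ b → suc b ≡ᵇ a) (adj-path a<p) f)
    (cong₂ _+_ (sumBelow-sift f (ℕP.<-≤-trans (s≤s a<p) p<n)) (sumBelow-sift-prev f (ℕP.<⇒≤ (ℕP.<-trans a<p p<n))))

  neighbours-centre : ∀ f → sumBelow n (λ b → adj p b * f b) ≡ prev p f + sumBelow k (λ t → f (suc p ℕ.+ t))
  neighbours-centre f = trans (neighbours-split (λ b → suc b ≡ᵇ p) (p <ᵇ_) adj-centre f)
    (cong₂ _+_ (sumBelow-sift-prev f (ℕP.<⇒≤ p<n)) (sumBelow-leaves f))

  neighbours-leaf : ∀ {a} → p < a → ∀ f → sumBelow n (λ b → adj a b * f b) ≡ f p
  neighbours-leaf p<a f = trans (sumBelow-cong n (λ b _ → cong (_* f b) (adj-leaf p<a b))) (sumBelow-sift f p<n)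

  degree-neighbours : ∀ a → degree a ≡ sumBelow n (λ b → adj a b * 1ℚ)
  degree-neighbours a = sumBelow-cong n (λ b _ → sym (ℚP.*-identityʳ (adj a b)))

  degree-path : ∀ {a} → a < p → degree a ≡ 1ℚ + prev a (λ _ → 1ℚ)
  degree-path {a} a<p = trans (degree-neighbours a) (neighbours-path a<p (λ _ → 1ℚ))

  degree-centre : degree p ≡ prev p (λ _ → 1ℚ) + ℕ→ℚ k
  degree-centre = trans (degree-neighbours p) (trans (neighbours-centre (λ _ → 1ℚ))
    (cong (prev p (λ _ → 1ℚ) +_) (trans (sumBelow-const k 1ℚ) (ℚP.*-identityʳ (ℕ→ℚ k)))))

  degree-leaf : ∀ {a} → p < a → degree a ≡ 1ℚ
  degree-leaf {a} p<a = trans (degree-neighbours a) (neighbours-leaf p<a (λ _ → 1ℚ))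

  slope : (ℕ → ℚ) → ℕ → ℚ
  slope f b = f b - f (suc b)

  lapℕ-path : ∀ {a} → a < p → ∀ f → lapℕ f a ≡ slope f a - prev a (slope f)
  lapℕ-path {a} a<p f = trans (cong₂ (λ d s → d * f a - s) (degree-path a<p) (neighbours-path a<p f)) (by-cases a)
    where
    by-cases : ∀ a → (1ℚ + prev a (λ _ → 1ℚ)) * f a - (f (suc a) + prev a f) ≡ slope f a - prev a (slope f)
    by-cases zero = solve 2 (λ x y → (con 1ℚ :+ con 0ℚ) :* x :- (y :+ con 0ℚ) := (x :- y) :- con 0ℚ) refl (f 0) (f 1)
    by-cases (suc b) = solve 3 (λ x y w → (con 1ℚ :+ con 1ℚ) :* x :- (y :+ w) := (x :- y) :- (w :- x)) refl
      (f (suc b)) (f (suc (suc b))) (f b)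

  lapℕ-centre : ∀ f → lapℕ f p ≡ (prev p (λ _ → 1ℚ) + ℕ→ℚ k) * f p - (prev p f + sumBelow k (λ t → f (suc p ℕ.+ t)))
  lapℕ-centre f = cong₂ (λ d s → d * f p - s) degree-centre (neighbours-centre f)

  lapℕ-leaf : ∀ {a} → p < a → ∀ f → lapℕ f a ≡ f a - f p
  lapℕ-leaf {a} p<a f = trans (cong₂ (λ d s → d * f a - s) (degree-leaf p<a) (neighbours-leaf p<a f))
    (cong (_- f p) (ℚP.*-identityˡ (f a)))

  δ : ℕ → ℕ → ℚ
  δ i a = ind (i ≡ᵇ a)

  δ-≢ : ∀ {i a} → i ≢ a → δ i a ≡ 0ℚ
  δ-≢ i≢a = cong ind (≢⇒≡ᵇ≡false i≢a)

  δ-refl : ∀ i → δ i i ≡ 1ℚ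
  δ-refl i = cong ind (≡ᵇ-refl i)

  pathPotential : ℕ → ℕ → ℚ
  pathPotential i b = ℕ→ℚ (p ∸ (i ⊔ b))

  pathPotential-beyond : ∀ i {b} → p ≤ b → pathPotential i b ≡ 0ℚ
  pathPotential-beyond i {b} p≤b = cong ℕ→ℚ (ℕP.m≤n⇒m∸n≡0 (ℕP.≤-trans p≤b (ℕP.m≤n⊔m i b)))

  slope-pathPotential : ∀ i {b} → b < p → slope (pathPotential i) b ≡ ind (i <ᵇ suc b)
  slope-pathPotential i {b} b<p with ℕP.≤-<-connex i b
  ... | inj₁ i≤b rewrite ℕP.m≤n⇒m⊔n≡n i≤b | ℕP.m≤n⇒m⊔n≡n (ℕP.m≤n⇒m≤1+n i≤b) | <⇒<ᵇ≡true (s≤s i≤b) = begin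
    ℕ→ℚ (p ∸ b) - ℕ→ℚ (p ∸ suc b)
      ≡⟨ cong₂ _-_ (ℕ→ℚ-∸ (ℕP.<⇒≤ b<p)) (ℕ→ℚ-∸ b<p) ⟩
    (ℕ→ℚ p - ℕ→ℚ b) - (ℕ→ℚ p - ℕ→ℚ (suc b))
      ≡⟨ cong (λ x → (ℕ→ℚ p - ℕ→ℚ b) - (ℕ→ℚ p - x)) (ℕ→ℚ-suc b) ⟩
    (ℕ→ℚ p - ℕ→ℚ b) - (ℕ→ℚ p - (1ℚ + ℕ→ℚ b))
      ≡⟨ solve 2 (λ x y → (x :- y) :- (x :- (con 1ℚ :+ y)) := con 1ℚ) refl (ℕ→ℚ p) (ℕ→ℚ b) ⟩
    1ℚ
      ∎
    where open ≡-Reasoning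
  ... | inj₂ b<i rewrite ℕP.m≥n⇒m⊔n≡m (ℕP.<⇒≤ b<i) | ℕP.m≥n⇒m⊔n≡m b<i | ≤⇒<ᵇ≡false b<i =
    ℚP.+-inverseʳ (ℕ→ℚ (p ∸ i))

  lap-pathPotential : ∀ {i} → i ≤ p → ∀ a → lapℕ (pathPotential i) a ≡ δ i a - δ p a
  lap-pathPotential {i} i≤p a with ℕP.<-cmp a p
  ... | tri< a<p _ _ rewrite δ-≢ (ℕP.>⇒≢ a<p) = trans (lapℕ-path a<p (pathPotential i)) (interior a a<p)
    where
    interior : ∀ a → a < p → slope (pathPotential i) a - prev a (slope (pathPotential i)) ≡ δ i a - 0ℚ
    interior zero 0<p rewrite slope-pathPotential i 0<p | ind-<ᵇ-suc i 0 =
      solve 1 (λ x → (con 0ℚ :+ x) :- con 0ℚ := x :- con 0ℚ) refl (δ i 0)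
    interior (suc b) b+1<p rewrite slope-pathPotential i b+1<p | slope-pathPotential i (ℕP.<-trans (ℕP.n<1+n b) b+1<p)
                                 | ind-<ᵇ-suc i (suc b) =
      solve 2 (λ x y → (x :+ y) :- x := y :- con 0ℚ) refl (ind (i <ᵇ suc b)) (δ i (suc b))
  ... | tri≈ _ refl _ = begin
    lapℕ (pathPotential i) p
      ≡⟨ lapℕ-centre (pathPotential i) ⟩
    (prev p (λ _ → 1ℚ) + ℕ→ℚ k) * pathPotential i p - (prev p (pathPotential i) + sumBelow k (λ t → pathPotential i (suc p ℕ.+ t)))
      ≡⟨ cong₃ (λ x y z → (prev p (λ _ → 1ℚ) + ℕ→ℚ k) * x - (y + z))
               (pathPotential-beyond i ℕP.≤-refl) (prev-monus p i≤p)
               (sumBelow-0 k (λ t _ → pathPotential-beyond i (ℕP.≤-trans (ℕP.n≤1+n p) (ℕP.m≤m+n (suc p) t)))) ⟩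
    (prev p (λ _ → 1ℚ) + ℕ→ℚ k) * 0ℚ - ((1ℚ - δ i p) + 0ℚ)
      ≡⟨ solve 2 (λ d x → d :* con 0ℚ :- ((con 1ℚ :- x) :+ con 0ℚ) := x :- con 1ℚ) refl (prev p (λ _ → 1ℚ) + ℕ→ℚ k) (δ i p) ⟩
    δ i p - 1ℚ
      ≡⟨ cong (δ i p -_) (sym (δ-refl p)) ⟩
    δ i p - δ p p
      ∎
    where open ≡-Reasoning
  ... | tri> _ _ p<a rewrite lapℕ-leaf p<a (pathPotential i) | pathPotential-beyond i (ℕP.<⇒≤ p<a)
                           | pathPotential-beyond i (ℕP.≤-refl {p})
                           | δ-≢ (ℕP.<⇒≢ (ℕP.≤-<-trans i≤p p<a)) | δ-≢ (ℕP.<⇒≢ p<a) = refl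

  δ-path : ∀ {i b} → p < i → b ≤ p → δ i b ≡ 0ℚ
  δ-path p<i b≤p = δ-≢ (ℕP.>⇒≢ (ℕP.≤-<-trans b≤p p<i))

  sumBelow-δ-leaves : ∀ {i} → p < i → i < n → sumBelow k (λ t → δ i (suc p ℕ.+ t)) ≡ 1ℚ
  sumBelow-δ-leaves {i} p<i i<n = begin
    sumBelow k (λ t → δ i (suc p ℕ.+ t))
      ≡⟨ sumBelow-cong k (λ t _ → trans (cong (λ j → ind (j ≡ᵇ suc p ℕ.+ t)) (sym i≡p+1+s))
                                         (trans (cong ind (≡ᵇ-+ (suc p) s t)) (sym (ℚP.*-identityʳ (ind (s ≡ᵇ t)))))) ⟩
    sumBelow k (λ t → ind (s ≡ᵇ t) * 1ℚ)
      ≡⟨ sumBelow-sift (λ _ → 1ℚ) (ℕP.+-cancelˡ-< (suc p) s k (subst (_< n) (sym i≡p+1+s) i<n)) ⟩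
    1ℚ
      ∎
    where
    open ≡-Reasoning
    s = i ∸ suc p
    i≡p+1+s : suc p ℕ.+ s ≡ i
    i≡p+1+s = ℕP.m+[n∸m]≡n p<i

  lap-leafPotential : ∀ {i} → p < i → i < n → ∀ a → lapℕ (δ i) a ≡ δ i a - δ p a
  lap-leafPotential {i} p<i i<n a with ℕP.<-cmp a p
  ... | tri< a<p _ _ = begin
    lapℕ (δ i) a
      ≡⟨ lapℕ-path a<p (δ i) ⟩
    slope (δ i) a - prev a (slope (δ i))
      ≡⟨ cong₂ _-_ (flat a<p) (prev-cong a (λ b b+1≡a → flat (ℕP.<-trans (ℕP.≤-reflexive b+1≡a) a<p))) ⟩
    0ℚ - prev a (λ _ → 0ℚ)
      ≡⟨ cong₂ _-_ (sym (δ-path p<i (ℕP.<⇒≤ a<p))) (trans (prev-zero a) (sym (δ-≢ (ℕP.>⇒≢ a<p)))) ⟩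
    δ i a - δ p a
      ∎
    where
    open ≡-Reasoning
    flat : ∀ {b} → b < p → slope (δ i) b ≡ 0ℚ
    flat b<p = cong₂ _-_ (δ-path p<i (ℕP.<⇒≤ b<p)) (δ-path p<i b<p)
  ... | tri≈ _ refl _ = begin
    lapℕ (δ i) p
      ≡⟨ lapℕ-centre (δ i) ⟩
    (prev p (λ _ → 1ℚ) + ℕ→ℚ k) * δ i p - (prev p (δ i) + sumBelow k (λ t → δ i (suc p ℕ.+ t)))
      ≡⟨ cong₃ (λ x y z → (prev p (λ _ → 1ℚ) + ℕ→ℚ k) * x - (y + z))
               (δ-path p<i ℕP.≤-refl)
               (trans (prev-cong p (λ b b+1≡p → δ-path p<i (ℕP.<⇒≤ (ℕP.≤-reflexive b+1≡p)))) (prev-zero p))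
               (sumBelow-δ-leaves p<i i<n) ⟩
    (prev p (λ _ → 1ℚ) + ℕ→ℚ k) * 0ℚ - (0ℚ + 1ℚ)
      ≡⟨ solve 1 (λ d → d :* con 0ℚ :- (con 0ℚ :+ con 1ℚ) := con 0ℚ :- con 1ℚ) refl (prev p (λ _ → 1ℚ) + ℕ→ℚ k) ⟩
    0ℚ - 1ℚ
      ≡⟨ cong₂ _-_ (sym (δ-path p<i ℕP.≤-refl)) (sym (δ-refl p)) ⟩
    δ i p - δ p p
      ∎
    where open ≡-Reasoning
  ... | tri> _ _ p<a = begin
    lapℕ (δ i) a      ≡⟨ lapℕ-leaf p<a (δ i) ⟩
    δ i a - δ i p     ≡⟨ cong (δ i a -_) (trans (δ-path p<i ℕP.≤-refl) (sym (δ-≢ (ℕP.<⇒≢ p<a)))) ⟩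
    δ i a - δ p a     ∎
    where open ≡-Reasoning

  U : ℕ → ℕ → ℚ
  U i = if i <ᵇ suc p then pathPotential i else δ i

  U-path : ∀ {i} → i ≤ p → U i ≡ pathPotential i
  U-path i≤p rewrite <⇒<ᵇ≡true (s≤s i≤p) = refl

  U-leaf : ∀ {i} → p < i → U i ≡ δ i
  U-leaf p<i rewrite ≤⇒<ᵇ≡false p<i = refl

  lap-U : ∀ {i} → i < n → ∀ a → lapℕ (U i) a ≡ δ i a - δ p a
  lap-U {i} i<n a with ℕP.≤-<-connex i p
  ... | inj₁ i≤p = trans (cong (λ f → lapℕ f a) (U-path i≤p)) (lap-pathPotential i≤p a)
  ... | inj₂ p<i = trans (cong (λ f → lapℕ f a) (U-leaf p<i)) (lap-leafPotential p<i i<n a)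

  U-centre : ∀ i → U i p ≡ 0ℚ
  U-centre i with ℕP.≤-<-connex i p
  ... | inj₁ i≤p = trans (cong (λ f → f p) (U-path i≤p)) (pathPotential-beyond i ℕP.≤-refl)
  ... | inj₂ p<i = trans (cong (λ f → f p) (U-leaf p<i)) (δ-≢ (ℕP.>⇒≢ p<i))

  P K V : ℚ
  P = ℕ→ℚ p
  K = ℕ→ℚ k
  V = (P + K) + (P + K)

  vol-dandelion : sumBelow n degree ≡ V
  vol-dandelion = begin
    sumBelow n degree
      ≡⟨ sumBelow-vertices degree ⟩
    (sumBelow p degree + degree p) + sumBelow k (λ t → degree (suc p ℕ.+ t))
      ≡⟨ cong₃ (λ x y z → (x + y) + z) (trans (sumBelow-cong p (λ a → degree-path)) (sumBelow-pathDegree p)) degree-centre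
               (trans (sumBelow-cong k (λ t _ → degree-leaf (p<leaf t))) (trans (sumBelow-const k 1ℚ) (ℚP.*-identityʳ K))) ⟩
    ((P + P - prev p (λ _ → 1ℚ)) + (prev p (λ _ → 1ℚ) + K)) + K
      ≡⟨ solve 3 (λ P t K → ((P :+ P :- t) :+ (t :+ K)) :+ K := (P :+ K) :+ (P :+ K)) refl P (prev p (λ _ → 1ℚ)) K ⟩
    V
      ∎
    where open ≡-Reasoning

  z : ℕ → ℚ
  z b = if b <ᵇ suc p then P * P - ℕ→ℚ b * ℕ→ℚ b else 1ℚ

  z-path : ∀ {b} → b ≤ p → z b ≡ P * P - ℕ→ℚ b * ℕ→ℚ b
  z-path b≤p rewrite <⇒<ᵇ≡true (s≤s b≤p) = refl

  z-leaf : ∀ {b} → p < b → z b ≡ 1ℚ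
  z-leaf p<b rewrite ≤⇒<ᵇ≡false p<b = refl

  z-centre : z p ≡ 0ℚ
  z-centre = trans (z-path ℕP.≤-refl) (ℚP.+-inverseʳ (P * P))

  slope-z : ∀ {b} → b < p → slope z b ≡ 1ℚ + (ℕ→ℚ b + ℕ→ℚ b)
  slope-z {b} b<p = begin
    z b - z (suc b)                                       ≡⟨ cong₂ _-_ (z-path (ℕP.<⇒≤ b<p)) (z-path b<p) ⟩
    (P * P - ℕ→ℚ b * ℕ→ℚ b) - (P * P - ℕ→ℚ (suc b) * ℕ→ℚ (suc b))
      ≡⟨ cong (λ x → (P * P - ℕ→ℚ b * ℕ→ℚ b) - (P * P - x * x)) (ℕ→ℚ-suc b) ⟩
    (P * P - ℕ→ℚ b * ℕ→ℚ b) - (P * P - (1ℚ + ℕ→ℚ b) * (1ℚ + ℕ→ℚ b))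
      ≡⟨ solve 2 (λ P B → (P :* P :- B :* B) :- (P :* P :- (con 1ℚ :+ B) :* (con 1ℚ :+ B)) := con 1ℚ :+ (B :+ B)) refl P (ℕ→ℚ b) ⟩
    1ℚ + (ℕ→ℚ b + ℕ→ℚ b)                                  ∎
    where open ≡-Reasoning

  lap-z : ∀ a → lapℕ z a ≡ degree a - V * δ p a
  lap-z a with ℕP.<-cmp a p
  ... | tri< a<p _ _ = begin
    lapℕ z a
      ≡⟨ lapℕ-path a<p z ⟩
    slope z a - prev a (slope z)
      ≡⟨ cong₂ _-_ (slope-z a<p) (prev-cong a (λ b b+1≡a → slope-z (ℕP.<-trans (ℕP.≤-reflexive b+1≡a) a<p))) ⟩
    (1ℚ + (ℕ→ℚ a + ℕ→ℚ a)) - prev a (λ b → 1ℚ + (ℕ→ℚ b + ℕ→ℚ b))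
      ≡⟨ second-difference a ⟩
    (1ℚ + prev a (λ _ → 1ℚ)) - V * 0ℚ
      ≡⟨ cong₂ _-_ (sym (degree-path a<p)) (cong (V *_) (sym (δ-≢ (ℕP.>⇒≢ a<p)))) ⟩
    degree a - V * δ p a
      ∎
    where
    open ≡-Reasoning
    second-difference : ∀ a →
      (1ℚ + (ℕ→ℚ a + ℕ→ℚ a)) - prev a (λ b → 1ℚ + (ℕ→ℚ b + ℕ→ℚ b)) ≡ (1ℚ + prev a (λ _ → 1ℚ)) - V * 0ℚ
    second-difference zero = solve 1 (λ V → (con 1ℚ :+ (con 0ℚ :+ con 0ℚ)) :- con 0ℚ := (con 1ℚ :+ con 0ℚ) :- V :* con 0ℚ) refl V
    second-difference (suc b) = trans (cong (λ x → (1ℚ + (x + x)) - (1ℚ + (ℕ→ℚ b + ℕ→ℚ b))) (ℕ→ℚ-suc b))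
      (solve 2 (λ B V → (con 1ℚ :+ ((con 1ℚ :+ B) :+ (con 1ℚ :+ B))) :- (con 1ℚ :+ (B :+ B)) := (con 1ℚ :+ con 1ℚ) :- V :* con 0ℚ)
        refl (ℕ→ℚ b) V)
  ... | tri≈ _ refl _ = begin
    lapℕ z p
      ≡⟨ lapℕ-centre z ⟩
    (prev p (λ _ → 1ℚ) + K) * z p - (prev p z + sumBelow k (λ t → z (suc p ℕ.+ t)))
      ≡⟨ cong₃ (λ x y w → (prev p (λ _ → 1ℚ) + K) * x - (y + w)) z-centre
               (trans (prev-cong p (λ b b+1≡p → z-path (ℕP.<⇒≤ (ℕP.≤-reflexive b+1≡p)))) (prev-squares p))
               (trans (sumBelow-cong k (λ t _ → z-leaf (p<leaf t))) (trans (sumBelow-const k 1ℚ) (ℚP.*-identityʳ K))) ⟩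
    (prev p (λ _ → 1ℚ) + K) * 0ℚ - (((P + P) - prev p (λ _ → 1ℚ)) + K)
      ≡⟨ solve 3 (λ t P K → (t :+ K) :* con 0ℚ :- (((P :+ P) :- t) :+ K) := (t :+ K) :- ((P :+ K) :+ (P :+ K)) :* con 1ℚ)
           refl (prev p (λ _ → 1ℚ)) P K ⟩
    (prev p (λ _ → 1ℚ) + K) - V * 1ℚ
      ≡⟨ cong₂ _-_ (sym degree-centre) (cong (V *_) (sym (δ-refl p))) ⟩
    degree p - V * δ p p
      ∎
    where open ≡-Reasoning
  ... | tri> _ _ p<a = begin
    lapℕ z a           ≡⟨ lapℕ-leaf p<a z ⟩
    z a - z p          ≡⟨ cong₂ _-_ (z-leaf p<a) z-centre ⟩
    1ℚ - 0ℚ            ≡⟨ solve 1 (λ V → con 1ℚ :- con 0ℚ := con 1ℚ :- V :* con 0ℚ) refl V ⟩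
    1ℚ - V * 0ℚ        ≡⟨ cong₂ _-_ (sym (degree-leaf p<a)) (cong (V *_) (sym (δ-≢ (ℕP.<⇒≢ p<a)))) ⟩
    degree a - V * δ p a ∎
    where open ≡-Reasoning

  halfResistanceSum : ℚ
  halfResistanceSum = (V * P * P - third * (ℕ→ℚ 4 * (P * P * P) - P)) + K * (V - 1ℚ)

  weighted-drop-sum : sumBelow n (λ a → degree a * (U a a * V - (z a - z p))) ≡ halfResistanceSum
  weighted-drop-sum = begin
    sumBelow n H
      ≡⟨ sumBelow-vertices H ⟩
    (sumBelow p H + H p) + sumBelow k (λ t → H (suc p ℕ.+ t))
      ≡⟨ cong₃ (λ x y w → (x + y) + w) (trans (sumBelow-cong p path) (sumBelow-pathTerm V p)) centre
               (trans (sumBelow-cong k (λ t _ → leaf (p<leaf t))) (sumBelow-const k (V - 1ℚ))) ⟩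
    ((V * P * P - third * (ℕ→ℚ 4 * (P * P * P) - P)) + 0ℚ) + K * (V - 1ℚ)
      ≡⟨ cong (_+ K * (V - 1ℚ)) (ℚP.+-identityʳ (V * P * P - third * (ℕ→ℚ 4 * (P * P * P) - P))) ⟩
    (V * P * P - third * (ℕ→ℚ 4 * (P * P * P) - P)) + K * (V - 1ℚ)
      ∎
    where
    open ≡-Reasoning
    H : ℕ → ℚ
    H a = degree a * (U a a * V - (z a - z p))
    path : ∀ a → a < p → H a ≡ pathTerm V p a
    path a a<p = begin
      H a
        ≡⟨ cong₃ (λ d u w → d * (u * V - (w - z p))) (degree-path a<p) U-diagonal (z-path (ℕP.<⇒≤ a<p)) ⟩
      (1ℚ + prev a (λ _ → 1ℚ)) * ((P - ℕ→ℚ a) * V - ((P * P - ℕ→ℚ a * ℕ→ℚ a) - z p))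
        ≡⟨ cong (λ w → (1ℚ + prev a (λ _ → 1ℚ)) * ((P - ℕ→ℚ a) * V - ((P * P - ℕ→ℚ a * ℕ→ℚ a) - w))) z-centre ⟩
      (1ℚ + prev a (λ _ → 1ℚ)) * ((P - ℕ→ℚ a) * V - ((P * P - ℕ→ℚ a * ℕ→ℚ a) - 0ℚ))
        ≡⟨ cong (λ w → (1ℚ + prev a (λ _ → 1ℚ)) * ((P - ℕ→ℚ a) * V - w)) (ℚP.+-identityʳ (P * P - ℕ→ℚ a * ℕ→ℚ a)) ⟩
      pathTerm V p a
        ∎
      where
      U-diagonal : U a a ≡ P - ℕ→ℚ a
      U-diagonal = trans (cong (λ f → f a) (U-path (ℕP.<⇒≤ a<p)))
        (trans (cong (λ m → ℕ→ℚ (p ∸ m)) (ℕP.⊔-idem a)) (ℕ→ℚ-∸ (ℕP.<⇒≤ a<p)))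
    centre : H p ≡ 0ℚ
    centre = trans (cong₂ (λ u w → degree p * (u * V - (w - w))) (U-centre p) z-centre)
      (solve 2 (λ d V → d :* (con 0ℚ :* V :- (con 0ℚ :- con 0ℚ)) := con 0ℚ) refl (degree p) V)
    leaf : ∀ {a} → p < a → H a ≡ V - 1ℚ
    leaf {a} p<a = trans (cong₃ (λ d u w → d * (u * V - (w - z p)))
                                (degree-leaf p<a) (trans (cong (λ f → f a) (U-leaf p<a)) (δ-refl a)) (z-leaf p<a))
      (trans (cong (λ w → 1ℚ * (1ℚ * V - (1ℚ - w))) z-centre)
        (solve 1 (λ V → con 1ℚ :* (con 1ℚ :* V :- (con 1ℚ :- con 0ℚ)) := V :- con 1ℚ) refl V))

  kemeny-value : inv (ℕ→ℚ 4 * ((ℤ.+ 1 / 2) * V)) * (halfResistanceSum + halfResistanceSum)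
    ≡ kemenyFormula (ℕ→ℚ (suc n)) (ℕ→ℚ n) (ℕ→ℚ (suc p))
  kemeny-value = begin
    inv (ℕ→ℚ 4 * ((ℤ.+ 1 / 2) * V)) * (halfResistanceSum + halfResistanceSum)
      ≡⟨ cong (_* (halfResistanceSum + halfResistanceSum)) (inv-multiple (ℕ→ℚ 4) (λ ()) four-edges) ⟩
    (inv (ℕ→ℚ 4) * inv t) * (halfResistanceSum + halfResistanceSum)
      -- with every inverse written as a constant times inv t, what is left is a polynomial identity
      ≡⟨ solve 3 (λ P K i →
           (con (inv (ℕ→ℚ 4)) :* i) :* (T′ P K :+ T′ P K)
           := ((con 1ℚ :+ (con 1ℚ :+ (P :+ K))) :* (con (ℕ→ℚ 2) :* (con 1ℚ :+ P) :* (con 1ℚ :+ P) :- con 1ℚ)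
                :+ con (ℕ→ℚ 2) :* (con 1ℚ :+ (P :+ K)) :* ((con 1ℚ :+ (P :+ K)) :- con (ℕ→ℚ 3) :* (con 1ℚ :+ P)))
                :* (con (inv (ℕ→ℚ 2)) :* i)
              :+ ((con 1ℚ :+ P) :* (con (ℕ→ℚ 5) :- con (ℕ→ℚ 2) :* (con 1ℚ :+ P) :* (con 1ℚ :+ P))) :* (con (inv (ℕ→ℚ 3)) :* i))
           refl P K (inv t) ⟩
    (N⁺ * (ℕ→ℚ 2 * L * L - 1ℚ) + ℕ→ℚ 2 * N * (N - ℕ→ℚ 3 * L)) * (inv (ℕ→ℚ 2) * inv t)
      + (L * (ℕ→ℚ 5 - ℕ→ℚ 2 * L * L)) * (inv (ℕ→ℚ 3) * inv t)
      ≡⟨ sym (cong₂ (λ x y → (N⁺ * (ℕ→ℚ 2 * L * L - 1ℚ) + ℕ→ℚ 2 * N * (N - ℕ→ℚ 3 * L)) * x + (L * (ℕ→ℚ 5 - ℕ→ℚ 2 * L * L)) * y)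
                    (inv-multiple (ℕ→ℚ 2) (λ ()) (shift (ℕ→ℚ 2))) (inv-multiple (ℕ→ℚ 3) (λ ()) (shift (ℕ→ℚ 3)))) ⟩
    kemenyFormula N⁺ N L
      ≡⟨ sym (cong₃ kemenyFormula (trans (ℕ→ℚ-suc n) (cong (1ℚ +_) n≡)) n≡ (ℕ→ℚ-suc p)) ⟩
    kemenyFormula (ℕ→ℚ (suc n)) (ℕ→ℚ n) (ℕ→ℚ (suc p))
      ∎
    where
    open ≡-Reasoning
    t N N⁺ L : ℚ
    t = P + K
    N = 1ℚ + t
    N⁺ = 1ℚ + N
    L = 1ℚ + P
    n≡ : ℕ→ℚ n ≡ N
    n≡ = trans (ℕ→ℚ-suc (p ℕ.+ k)) (cong (1ℚ +_) (ℕ→ℚ-+ p k))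
    inv-multiple : ∀ c {x} → c ≢ 0ℚ → x ≡ c * t → inv x ≡ inv c * inv t
    inv-multiple c c≢0 x≡ct = trans (cong inv x≡ct) (inv-* t c≢0)
    four-edges : ℕ→ℚ 4 * ((ℤ.+ 1 / 2) * V) ≡ ℕ→ℚ 4 * t
    four-edges = solve 2 (λ P K → con (ℕ→ℚ 4) :* (con (ℤ.+ 1 / 2) :* ((P :+ K) :+ (P :+ K))) := con (ℕ→ℚ 4) :* (P :+ K))
      refl P K
    shift : ∀ c → c * (N - 1ℚ) ≡ c * t
    shift c = cong (c *_) (solve 1 (λ t → (con 1ℚ :+ t) :- con 1ℚ := t) refl t)
    T′ : ∀ {m} → Polynomial m → Polynomial m → Polynomial m
    T′ P K = (((P :+ K) :+ (P :+ K)) :* P :* P :- con third :* (con (ℕ→ℚ 4) :* (P :* P :* P) :- P))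
             :+ K :* (((P :+ K) :+ (P :+ K)) :- con 1ℚ)

  A : Adj n
  A = dandelion n (suc p)

  centre : Fin n
  centre = Fin.fromℕ< p<n

  lap-U-at : ∀ i c → lap A (λ j → U (toℕ i) (toℕ j)) c ≡ e i c - e centre c
  lap-U-at i c = trans (lap-dandelion (U (toℕ i)) c) (trans (lap-U (toℕ<n i) (toℕ c))
    (cong (λ m → δ (toℕ i) (toℕ c) - δ m (toℕ c)) (sym (toℕ-fromℕ< p<n))))

  open GroundedPotentials A centre (λ i j → U (toℕ i) (toℕ j)) lap-U-at

  kemeny-potentials : kemeny A potentials ≡ dandelionKemeny n (suc p)
  kemeny-potentials = begin
    kemeny A potentials
      ≡⟨ cong (inv (ℕ→ℚ 4 * edges A) *_) (resistance-sum (dandelion-symmetric n (suc p)) U-at-centre (λ j → z (toℕ j)) lap-z-at) ⟩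
    inv (ℕ→ℚ 4 * edges A) * (T₀ + T₀)
      ≡⟨ cong₂ (λ v s → inv (ℕ→ℚ 4 * ((ℤ.+ 1 / 2) * v)) * (s + s)) vol-dandelion
           (trans (cong₂ (λ v w → sumBelow n (λ a → degree a * (U a a * v - (z a - w)))) vol-dandelion (cong z (toℕ-fromℕ< p<n)))
                  weighted-drop-sum) ⟩
    inv (ℕ→ℚ 4 * ((ℤ.+ 1 / 2) * V)) * (halfResistanceSum + halfResistanceSum)
      ≡⟨ kemeny-value ⟩
    kemenyFormula (ℕ→ℚ (suc n)) (ℕ→ℚ n) (ℕ→ℚ (suc p))
      ≡⟨ sym (dandelionKemeny-formula n (suc p)) ⟩
    dandelionKemeny n (suc p)
      ∎
    where
    open ≡-Reasoning
    T₀ : ℚ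
    T₀ = sumBelow n (λ a → degree a * (U a a * sumBelow n degree - (z a - z (toℕ centre))))
    U-at-centre : ∀ i → U (toℕ i) (toℕ centre) ≡ 0ℚ
    U-at-centre i = trans (cong (U (toℕ i)) (toℕ-fromℕ< p<n)) (U-centre (toℕ i))
    lap-z-at : ∀ c → lap A (λ j → z (toℕ j)) c ≡ deg A c - vol A * e centre c
    lap-z-at c = trans (lap-dandelion z c) (trans (lap-z (toℕ c))
      (cong₂ (λ v m → degree (toℕ c) - v * δ m (toℕ c)) (sym vol-dandelion) (sym (toℕ-fromℕ< p<n))))

  kemeny-dandelion : Σ (Fin n → Fin n → Fin n → ℚ) (IsPotentials A)
    × (∀ Q → IsPotentials A Q → kemeny A Q ≡ dandelionKemeny n (suc p))
  kemeny-dandelion = (potentials , potentials-isPotentials)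
    , λ Q Q-pot → trans (kemeny-unique A (dandelion-symmetric n (suc p)) Q-pot potentials-isPotentials) kemeny-potentials

corollary3p7 : (n l : ℕ) → 1 ≤ l → l < n →
    Σ (Fin n → Fin n → Fin n → ℚ) (IsPotentials (dandelion n l))
    × (∀ (P : Fin n → Fin n → Fin n → ℚ) → IsPotentials (dandelion n l) P →
         kemeny (dandelion n l) P ≡ dandelionKemeny n l)
corollary3p7 n (suc p) _ l<n with n ∸ suc p | ℕP.m+[n∸m]≡n (ℕP.<⇒≤ l<n)
... | k | refl = Dandelion.kemeny-dandelion p k
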